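{- For every object $A$ generated by the grammar $A::=X\mid A\otimes A\mid\,!A$, every occurrence of $X$ in $A$, and every natural number $x\ge2$, we have $b^-<\theta_A(x)$, where $b^-$ is one less than the number of occurrences of $X$ in $A$.
   Context: Let $X$ be a fixed object regarded as atomic, and consider objects generated by $A::=X\mid A\otimes A\mid\,!A$. For an occurrence of $X$ in $A$, define an arithmetic expression $\theta_A(x)$ in a variable $x$ recursively: if $A=X$ then $\theta_X(x)=x$; $\theta_{!A}(x)=2\theta_A(x)$; if the occurrence lies in $A$, then $\theta_{A\otimes A'}(x)=b+\theta_A(x)$ and $\theta_{A'\otimes A}(x)=b+\theta_A(x)$, where $b$ is the number of occurrences of $X$ in $A'$. The variable $x$ ranges over natural numbers $\ge 2$ (standing assumption of the paper). -}

module Defs where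

open import Data.Nat using (ℕ; zero; suc; _+_; _*_)

data Obj : Set where
  X   : Obj
  _⊗_ : Obj → Obj → Obj
  !_  : Obj → Obj

infixr 6 _⊗_
infix 8 !_

data Occ : Obj → Set where
  here  : Occ X
  left  : {A B : Obj} → Occ A → Occ (A ⊗ B)
  right : {A B : Obj} → Occ B → Occ (A ⊗ B)
  bang  : {A : Obj} → Occ A → Occ (! A)

count : Obj → ℕ
count X       = 1
count (A ⊗ B) = count A + count B
count (! A)   = count A

θ : (A : Obj) → Occ A → ℕ → ℕ
θ X       here      x = x
θ (! A)   (bang o)  x = 2 * θ A o x
θ (A ⊗ B) (left o)  x = count B + θ A o x
θ (A ⊗ B) (right o) x = count A + θ B o x

-- The weight θ_A(x) of an occurrence of X dominates the number of
-- occurrences of X in A, as soon as x ≥ 1: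
--
--   count A ≤ θ A o x.
--
-- This is proved by induction along the occurrence: the leaf contributes x,
-- a tensor adds exactly the count of the sibling factor, and ! doubles the
-- weight while leaving the count unchanged.  Since every object contains at
-- least one X, count A ∸ 1 is strictly below count A, and the theorem
-- (where the paper's standing assumption x ≥ 2 is more than enough) follows.
module Submission where

open import Defs
open import Data.Nat using (ℕ; _≤_; _<_; _∸_; s≤s; z≤n)
open import Data.Nat.Properties
  using (≤-trans; m≤m+n; +-comm; +-monoʳ-≤; ≤-reflexive; ∸-monoˡ-<)

count-positive : (A : Obj) → 1 ≤ count A
count-positive X       = s≤s z≤n
count-positive (A ⊗ B) = ≤-trans (count-positive A) (m≤m+n (count A) (count B))
count-positive (! A)   = count-positive A

-- The weight of any occurrence bounds the number of occurrences from above,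
-- for every x ≥ 1.  In the ! case θ doubles (2 * t = t + (t + 0)), so the
-- old bound persists; in the ⊗ cases both sides grow by the sibling's count.
count≤θ : (A : Obj) (o : Occ A) (x : ℕ) → 1 ≤ x → count A ≤ θ A o x
count≤θ X       here      x 1≤x = 1≤x
count≤θ (! A)   (bang o)  x 1≤x = ≤-trans (count≤θ A o x 1≤x) (m≤m+n (θ A o x) _)
count≤θ (A ⊗ B) (left o)  x 1≤x =
  ≤-trans (≤-reflexive (+-comm (count A) (count B)))
          (+-monoʳ-≤ (count B) (count≤θ A o x 1≤x))
count≤θ (A ⊗ B) (right o) x 1≤x = +-monoʳ-≤ (count A) (count≤θ B o x 1≤x)

-- The theorem: b⁻ = count A ∸ 1 < θ_A(x).  Subtract 1 from both sides of
-- count A < 1 + θ A o x, which is legitimate because count A ≥ 1.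
mainTheorem18 : (A : Obj) (o : Occ A) (x : ℕ) → 2 ≤ x → count A ∸ 1 < θ A o x
mainTheorem18 A o x 2≤x =
  ∸-monoˡ-< (s≤s (count≤θ A o x 1≤x)) (count-positive A)
  where
  1≤x : 1 ≤ x
  1≤x = ≤-trans (s≤s z≤n) 2≤x
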